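{- Let $A$, $U_1$, $U_2$ be programs and $\sigma_1:L_{U_1}\to L_A$, $\sigma_2:L_{U_2}\to L_A$, $\mu:L_{U_1}\to L_{U_2}$ surjections. Suppose $U_1\preceq_{\sigma_1}A$ with $\tau(U_1)\Leftrightarrow\sigma_1(\tau_A)\wedge\rho_1$ for some transition relation $\rho_1$ on $L_{U_1}$. If $U_1\preceq_\mu U_2\preceq_{\sigma_2}A$ and $\sigma_1=\sigma_2\circ\mu$, then there exists a transition relation $\rho_2$ on $L_{U_2}$ such that $\tau(U_2)\Leftrightarrow\sigma_2(\tau_A)\wedge\rho_2$ and $\rho_1\Rightarrow\mu(\rho_2)$.
   Context: A program is a tuple $P=\langle L,\ell^o,\ell^e,V,\tau\rangle$: $L$ a finite set of control locations, $\ell^o,\ell^e\in L$ initial and error locations, $V$ a set of Boolean or rational variables, and $\tau:L\times L\to$ formulas over $V\cup V'$ in propositional linear rational arithmetic ($V'$ primed next-state copies); $\tau(P)$ or $\tau_P$ denotes this transition relation. A transition relation on a set $L$ is such a map $L\times L\to$ formulas, and implications/equivalences between transition relations are pointwise. For programs $P_1,P_2$ and a surjection $\sigma:L_1\to L_2$, $P_1\preceq_\sigma P_2$ iff $V_1=V_2$, $\sigma(\ell^o_1)=\ell^o_2$, $\sigma(\ell^e_1)=\ell^e_2$, and $\tau_1(\ell_i,\ell_j)\Rightarrow\tau_2(\sigma(\ell_i),\sigma(\ell_j))$ for all $\ell_i,\ell_j\in L_1$. For a transition relation $\tau$ on $L_2$, its embedding $\sigma(\tau)$ is the transition relation on $L_1$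 given by $\sigma(\tau)(\ell_1,\ell_2)=\tau(\sigma(\ell_1),\sigma(\ell_2))$. -}

module Defs where

open import Data.Nat using (ℕ)
open import Data.Fin using (Fin)
open import Data.Bool using (Bool) renaming (true to btrue; false to bfalse)
open import Data.Rational using (ℚ) renaming (_+_ to _+ℚ_; _*_ to _*ℚ_; _≤_ to _≤ℚ_; _<_ to _<ℚ_)
open import Data.Product using (_×_)
open import Data.Sum using (_⊎_)
open import Data.Unit using (⊤)
open import Data.Empty using (⊥)
open import Relation.Nullary using (¬_)
open import Relation.Binary.PropositionalEquality using (_≡_; subst)
open import Function.Definitions using (Surjective)

data Sort : Set where
  bool rat : Sort

⟦_⟧ˢ : Sort → Set
⟦ bool ⟧ˢ = Bool
⟦ rat ⟧ˢ = ℚ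

record VarSet : Set where
  field
    nv   : ℕ
    sort : Fin nv → Sort
open VarSet public

Valuation : VarSet → Set
Valuation V = (i : Fin (nv V)) → ⟦ sort V i ⟧ˢ

-- Linear rational terms over V ∪ V'.  The Bool flag selects the
-- primed (next-state) copy when true.
data Term (V : VarSet) : Set where
  const : ℚ → Term V
  var   : (primed : Bool) (i : Fin (nv V)) → sort V i ≡ rat → Term V
  _⊕_   : Term V → Term V → Term V
  scale : ℚ → Term V → Term V

data Formula (V : VarSet) : Set where
  true false : Formula V
  bvar  : (primed : Bool) (i : Fin (nv V)) → sort V i ≡ bool → Formula V
  _≤ₜ_ _<ₜ_ _=ₜ_ : Term V → Term V → Formula V
  ¬ᶠ_   : Formula V → Formula V
  _∧ᶠ_ _∨ᶠ_ : Formula V → Formula V → Formula V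

module _ {V : VarSet} where
  selectVal : Valuation V → Valuation V → Bool → Valuation V
  selectVal v v' bfalse = v
  selectVal v v' btrue  = v'

  evalT : Valuation V → Valuation V → Term V → ℚ
  evalT v v' (const q) = q
  evalT v v' (var p i eq) = subst ⟦_⟧ˢ eq (selectVal v v' p i)
  evalT v v' (t ⊕ u) = evalT v v' t +ℚ evalT v v' u
  evalT v v' (scale q t) = q *ℚ evalT v v' t

  Sat : Valuation V → Valuation V → Formula V → Set
  Sat v v' true = ⊤
  Sat v v' false = ⊥
  Sat v v' (bvar p i eq) = subst ⟦_⟧ˢ eq (selectVal v v' p i) ≡ btrue
  Sat v v' (t ≤ₜ u) = evalT v v' t ≤ℚ evalT v v' u
  Sat v v' (t <ₜ u) = evalT v v' t <ℚ evalT v v' u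
  Sat v v' (t =ₜ u) = evalT v v' t ≡ evalT v v' u
  Sat v v' (¬ᶠ φ) = ¬ Sat v v' φ
  Sat v v' (φ ∧ᶠ ψ) = Sat v v' φ × Sat v v' ψ
  Sat v v' (φ ∨ᶠ ψ) = Sat v v' φ ⊎ Sat v v' ψ

  _⇒ᶠ_ : Formula V → Formula V → Set
  φ ⇒ᶠ ψ = ∀ (v v' : Valuation V) → Sat v v' φ → Sat v v' ψ

  _⇔ᶠ_ : Formula V → Formula V → Set
  φ ⇔ᶠ ψ = (φ ⇒ᶠ ψ) × (ψ ⇒ᶠ φ)

TransRel : VarSet → ℕ → Set
TransRel V n = Fin n → Fin n → Formula V

module _ {V : VarSet} {n : ℕ} where
  _⇒ᵗ_ : TransRel V n → TransRel V n → Set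
  τ₁ ⇒ᵗ τ₂ = ∀ i j → τ₁ i j ⇒ᶠ τ₂ i j

  _⇔ᵗ_ : TransRel V n → TransRel V n → Set
  τ₁ ⇔ᵗ τ₂ = ∀ i j → τ₁ i j ⇔ᶠ τ₂ i j

  _∧ᵗ_ : TransRel V n → TransRel V n → TransRel V n
  (τ₁ ∧ᵗ τ₂) i j = τ₁ i j ∧ᶠ τ₂ i j

-- Embedding σ(τ) of a transition relation τ on L₂ into L₁.
embed : {V : VarSet} {n₁ n₂ : ℕ} → (Fin n₁ → Fin n₂) → TransRel V n₂ → TransRel V n₁
embed σ τ i j = τ (σ i) (σ j)

record Program (V : VarSet) : Set where
  field
    nL    : ℕ
    init  : Fin nL
    err   : Fin nL
    trans : TransRel V nL
open Program public

IsSurjection : {n₁ n₂ : ℕ} → (Fin n₁ → Fin n₂) → Set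
IsSurjection = Surjective _≡_ _≡_

-- P₁ ⪯_σ P₂ (V₁ = V₂ is built in since both programs share V;
-- σ is additionally assumed surjective where it is introduced).
Refines : {V : VarSet} (P₁ P₂ : Program V) → (Fin (nL P₁) → Fin (nL P₂)) → Set
Refines P₁ P₂ σ =
  (σ (init P₁) ≡ init P₂) × (σ (err P₁) ≡ err P₂) ×
  (∀ i j → trans P₁ i j ⇒ᶠ trans P₂ (σ i) (σ j))

module Submission where

-- Take ρ₂ to be the implication σ₂(τ_A) → τ(U₂).  Since U₂ refines A,
-- τ(U₂) already implies σ₂(τ_A), so conjoining the two gives back τ(U₂).
-- For ρ₁ ⇒ μ(ρ₂) it suffices, by the deduction rule, that ρ₁ together with
-- μ(σ₂(τ_A)) = σ₁(τ_A) implies μ(τ(U₂)); this holds because ρ₁ ∧ σ₁(τ_A) is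
-- τ(U₁), which U₂ refines.  The deduction rule is valid here because
-- satisfaction of quantifier-free linear arithmetic is decidable.

open import Defs
open import Data.Bool using () renaming (true to btrue)
import Data.Bool.Properties as Bool
open import Data.Fin using (Fin)
open import Data.Nat using (ℕ)
open import Data.Product using (Σ; _×_; _,_; proj₂)
import Data.Rational.Properties as ℚ
open import Data.Sum using (inj₁; inj₂)
open import Data.Unit using (tt)
open import Relation.Nullary using (Dec; yes; no; contradiction)
open import Relation.Nullary.Decidable using (_×-dec_; _⊎-dec_; ¬?)
open import Relation.Binary.PropositionalEquality using (_≡_; cong₂; subst; sym)

module _ {V : VarSet} where

  sat? : (v v' : Valuation V) (φ : Formula V) → Dec (Sat v v' φ)
  sat? v v' true          = yes tt
  sat? v v' false         = no λ ()
  sat? v v' (bvar p i eq) = subst ⟦_⟧ˢ eq (selectVal v v' p i) Bool.≟ btrue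
  sat? v v' (t ≤ₜ u)      = evalT v v' t ℚ.≤? evalT v v' u
  sat? v v' (t <ₜ u)      = evalT v v' t ℚ.<? evalT v v' u
  sat? v v' (t =ₜ u)      = evalT v v' t ℚ.≟ evalT v v' u
  sat? v v' (¬ᶠ φ)        = ¬? (sat? v v' φ)
  sat? v v' (φ ∧ᶠ ψ)      = sat? v v' φ ×-dec sat? v v' ψ
  sat? v v' (φ ∨ᶠ ψ)      = sat? v v' φ ⊎-dec sat? v v' ψ

  _⟶ᶠ_ : Formula V → Formula V → Formula V
  ψ ⟶ᶠ φ = (¬ᶠ ψ) ∨ᶠ φ

  ⇒ᶠ⇒⇔ᶠ∧⟶ᶠ : {φ ψ : Formula V} → φ ⇒ᶠ ψ → φ ⇔ᶠ (ψ ∧ᶠ (ψ ⟶ᶠ φ))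
  ⇒ᶠ⇒⇔ᶠ∧⟶ᶠ φ⇒ψ = (λ v v' φ → φ⇒ψ v v' φ , inj₂ φ)
                 , λ { v v' (ψ , inj₁ ¬ψ) → contradiction ψ ¬ψ
                     ; v v' (_ , inj₂ φ)  → φ }

  curryᶠ : {χ ψ φ : Formula V} → (χ ∧ᶠ ψ) ⇒ᶠ φ → χ ⇒ᶠ (ψ ⟶ᶠ φ)
  curryᶠ {ψ = ψ} χ∧ψ⇒φ v v' χ with sat? v v' ψ
  ... | yes ψ-holds = inj₂ (χ∧ψ⇒φ v v' (χ , ψ-holds))
  ... | no  ¬ψ      = inj₁ ¬ψ

module _ {V : VarSet} {n : ℕ} where

  _⟶ᵗ_ : TransRel V n → TransRel V n → TransRel V n
  (ψ ⟶ᵗ φ) i j = ψ i j ⟶ᶠ φ i j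

  ⇒ᵗ⇒⇔ᵗ∧⟶ᵗ : {τ α : TransRel V n} → τ ⇒ᵗ α → τ ⇔ᵗ (α ∧ᵗ (α ⟶ᵗ τ))
  ⇒ᵗ⇒⇔ᵗ∧⟶ᵗ τ⇒α i j = ⇒ᶠ⇒⇔ᶠ∧⟶ᶠ (τ⇒α i j)

  curryᵗ : {χ ψ φ : TransRel V n} → (χ ∧ᵗ ψ) ⇒ᵗ φ → χ ⇒ᵗ (ψ ⟶ᵗ φ)
  curryᵗ χ∧ψ⇒φ i j = curryᶠ (χ∧ψ⇒φ i j)

embed-∘ : {V : VarSet} {n₁ n₂ n : ℕ} (τ : TransRel V n)
          {σ₁ : Fin n₁ → Fin n} (σ₂ : Fin n₂ → Fin n) (μ : Fin n₁ → Fin n₂) →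
          (∀ l → σ₁ l ≡ σ₂ (μ l)) → embed μ (embed σ₂ τ) ⇒ᵗ embed σ₁ τ
embed-∘ τ σ₂ μ σ₁≗σ₂∘μ i j v v' = subst (Sat v v') (sym (cong₂ τ (σ₁≗σ₂∘μ i) (σ₁≗σ₂∘μ j)))

lemma3 : {V : VarSet} (A U₁ U₂ : Program V)
    (σ₁ : Fin (nL U₁) → Fin (nL A)) (σ₂ : Fin (nL U₂) → Fin (nL A))
    (μ : Fin (nL U₁) → Fin (nL U₂)) →
    IsSurjection σ₁ → IsSurjection σ₂ → IsSurjection μ →
    Refines U₁ A σ₁ →
    (ρ₁ : TransRel V (nL U₁)) →
    trans U₁ ⇔ᵗ (embed σ₁ (trans A) ∧ᵗ ρ₁) →
    Refines U₁ U₂ μ → Refines U₂ A σ₂ →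
    (∀ l → σ₁ l ≡ σ₂ (μ l)) →
    Σ (TransRel V (nL U₂)) λ ρ₂ →
    (trans U₂ ⇔ᵗ (embed σ₂ (trans A) ∧ᵗ ρ₂)) × (ρ₁ ⇒ᵗ embed μ ρ₂)
lemma3 A U₁ U₂ σ₁ σ₂ μ _ _ _ _ ρ₁ τ₁⇔ (_ , _ , U₁⇒U₂) (_ , _ , U₂⇒A) σ₁≗σ₂∘μ =
  embed σ₂ (trans A) ⟶ᵗ trans U₂ , ⇒ᵗ⇒⇔ᵗ∧⟶ᵗ U₂⇒A , curryᵗ ρ₁∧A⇒U₂
  where
  ρ₁∧A⇒U₂ : (ρ₁ ∧ᵗ embed μ (embed σ₂ (trans A))) ⇒ᵗ embed μ (trans U₂)
  ρ₁∧A⇒U₂ i j v v' (ρ , α) =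
    U₁⇒U₂ i j v v' (proj₂ (τ₁⇔ i j) v v' (embed-∘ (trans A) σ₂ μ σ₁≗σ₂∘μ i j v v' α , ρ))
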